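{- Let $q$ be an even positive integer, $N_q=2^{2^{q/2}}$, and let $\phi_q$ be the coloring of the triples of $\{0,\dots,N_q-1\}$ defined, for $0\le x<y<z<N_q$, by \[ \phi_q(x,y,z)=\big(\delta(\delta(x,y),\delta(y,z)),\ \mathbb{1}\{\delta(x,y)>\delta(y,z)\}\big). \] If the complete $3$-graph on $\{0,\dots,N_q-1\}$ colored by $\phi_q$ contains a monochromatic copy of a $3$-graph $G$ (i.e. an injective map $V(G)\to\{0,\dots,N_q-1\}$ under which all edges of $G$ receive the same color), then $G\in\mathcal{U}$.
   Context: For a nonnegative integer $x$ with binary expansion $x=\sum_{i\ge0}a_i2^i$, write $\mathrm{bit}(x,i)=a_i$; for distinct nonnegative integers $x,y$, $\delta(x,y)=\max\{i\ge 0: \mathrm{bit}(x,i)\ne\mathrm{bit}(y,i)\}$. (For $x<y<z$ one has $\delta(x,y)\ne\delta(y,z)$, so $\phi_q$ is well defined and uses at most $q$ colors.) Collapsing: for a $3$-graph $G$, a set $U\subseteq V(G)$ with $2\le |U|<|V(G)|$ is collapsible if no edge of $G$ intersects $U$ in exactly two vertices. Given such $U$, with a new vertex $v^*$, let $H$ have vertex set $(V(G)\setminus U)\cup\{v^*\}$ and edge set $\{e\in E(G): e\cap U=\emptyset\}\cup\{xyv^*: \exists u\in U,\ xyu\in E(G)\}$; then $G$ is reducible to $(H,G[U])$. $\mathcal{U}_0$ is the set of tripartite $3$-graphs; $\mathcal{U}_1$ is the set of $3$-graphs having a vertex subset meeting every edge in exactly one vertex; for $i>1$, $\mathcal{U}_i$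 consists of $\mathcal{U}_{i-1}$ together with every $3$-graph reducible to some $(H,F)$ with $H\in\mathcal{U}_{i-1}$, $F\in\mathcal{U}_i$; $\mathcal{U}=\bigcup_{i\ge0}\mathcal{U}_i$. -}

module Defs where

open import Data.Nat using (ℕ; zero; suc; _+_; _≤_; _<_; _^_)
open import Data.Nat.DivMod using (_/_; _%_)
open import Data.Bool using (Bool; true; false; if_then_else_)
open import Data.Fin using (Fin)
open import Data.Fin.Subset using (Subset; _∈_; _∉_; ∣_∣)
open import Data.Vec using (lookup)
open import Data.Maybe using (Maybe; just; nothing)
open import Data.Product using (Σ; Σ-syntax; ∃; ∃-syntax; _×_)
open import Data.Sum using (_⊎_)
open import Data.Empty using (⊥)
open import Relation.Nullary using (¬_)
open import Relation.Binary.PropositionalEquality using (_≡_; _≢_)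
open import Function.Definitions using (Injective)
open import Function.Bundles using (_⇔_)

bit : ℕ → ℕ → ℕ
bit x zero    = x % 2
bit x (suc i) = bit (x / 2) i

-- δf k x y = the largest i < k with bit x i ≠ bit y i (0 if none)
δf : ℕ → ℕ → ℕ → ℕ
δf zero    x y = 0
δf (suc k) x y with bit x k Data.Nat.≟ bit y k
... | Relation.Nullary.yes _ = δf k x y
... | Relation.Nullary.no  _ = k

-- δ x y = max { i : bit x i ≠ bit y i }  (for x ≠ y).  All bits of
-- index ≥ x + y vanish for both x and y, so searching i < suc (x + y)
-- finds the true maximum.
δ : ℕ → ℕ → ℕ
δ x y = δf (suc (x + y)) x y

gtB : ℕ → ℕ → Bool
gtB a b with b Data.Nat.<? a
... | Relation.Nullary.yes _ = true
... | Relation.Nullary.no  _ = false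

φ : ℕ → ℕ → ℕ → ℕ × Bool
φ x y z = δ (δ x y) (δ y z) , gtB (δ x y) (δ y z)
  where open Data.Product using (_,_)

Nq : ℕ → ℕ
Nq q = 2 ^ (2 ^ (q / 2))

-- 3-graphs: vertex set Fin n, edges = 3-element sets, given by a
-- predicate on ordered triples that holds for all orderings of an edge
-- and only for triples of distinct vertices.

record Graph3 : Set₁ where
  field
    n     : ℕ
    E     : Fin n → Fin n → Fin n → Set
    E-distinct : ∀ {x y z} → E x y z → x ≢ y × y ≢ z × x ≢ z
    E-swap₁₂   : ∀ {x y z} → E x y z → E y x z
    E-swap₂₃   : ∀ {x y z} → E x y z → E x z y
open Graph3 public

b2n : Bool → ℕ
b2n true  = 1
b2n false = 0

count3 : ∀ {m} → Subset m → Fin m → Fin m → Fin m → ℕ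
count3 S x y z = b2n (lookup S x) + b2n (lookup S y) + b2n (lookup S z)

Tripartite : Graph3 → Set
Tripartite G = Σ[ c ∈ (Fin (n G) → Fin 3) ]
  (∀ x y z → E G x y z → c x ≢ c y × c y ≢ c z × c x ≢ c z)

HasTransversal : Graph3 → Set
HasTransversal G = Σ[ S ∈ Subset (n G) ] (∀ x y z → E G x y z → count3 S x y z ≡ 1)

Collapsible : (G : Graph3) → Subset (n G) → Set
Collapsible G U = 2 ≤ ∣ U ∣ × ∣ U ∣ < n G
  × (∀ x y z → E G x y z → count3 U x y z ≢ 2)

-- Edges of the collapsed graph, with vertex set (V(G) ∖ U) ∪ {v*},
-- where v* is represented by nothing and v ∈ V(G) ∖ U by just v.
CollapseEdge : (G : Graph3) → Subset (n G) →
  Maybe (Fin (n G)) → Maybe (Fin (n G)) → Maybe (Fin (n G)) → Set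
CollapseEdge G U (just x) (just y) (just z) = E G x y z × x ∉ U × y ∉ U × z ∉ U
CollapseEdge G U nothing  (just y) (just z) = ∃[ u ] (u ∈ U × E G y z u)
CollapseEdge G U (just x) nothing  (just z) = ∃[ u ] (u ∈ U × E G x z u)
CollapseEdge G U (just x) (just y) nothing  = ∃[ u ] (u ∈ U × E G x y u)
CollapseEdge G U _ _ _ = ⊥

IsoInduced : (G : Graph3) → Subset (n G) → Graph3 → Set
IsoInduced G U F = Σ[ f ∈ (Fin (n F) → Fin (n G)) ]
    Injective _≡_ _≡_ f
  × (∀ w → f w ∈ U)
  × (∀ v → v ∈ U → ∃[ w ] f w ≡ v)
  × (∀ a b c → E F a b c ⇔ E G (f a) (f b) (f c))

IsoCollapse : (G : Graph3) → Subset (n G) → Graph3 → Set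
IsoCollapse G U H = Σ[ g ∈ (Fin (n H) → Maybe (Fin (n G))) ]
    Injective _≡_ _≡_ g
  × (∀ w → g w ≡ nothing ⊎ ∃[ v ] (g w ≡ just v × v ∉ U))
  × (∃[ w ] g w ≡ nothing)
  × (∀ v → v ∉ U → ∃[ w ] g w ≡ just v)
  × (∀ a b c → E H a b c ⇔ CollapseEdge G U (g a) (g b) (g c))

Reducible : Graph3 → Graph3 → Graph3 → Set
Reducible G H F = Σ[ U ∈ Subset (n G) ]
  Collapsible G U × IsoCollapse G U H × IsoInduced G U F

data InU : ℕ → Graph3 → Set₁ where
  u₀  : ∀ {G} → Tripartite G → InU 0 G
  u₁  : ∀ {G} → HasTransversal G → InU 1 G
  old : ∀ {k G} → InU (suc k) G → InU (suc (suc k)) G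
  red : ∀ {k G} (H F : Graph3) → Reducible G H F →
        InU (suc k) H → InU (suc (suc k)) F → InU (suc (suc k)) G

InUnion : Graph3 → Set₁
InUnion G = Σ[ i ∈ ℕ ] InU i G

MonoCopy : ℕ → Graph3 → Set
MonoCopy N G = Σ[ f ∈ (Fin (n G) → ℕ) ]
    Injective _≡_ _≡_ f
  × (∀ v → f v < N)
  × Σ[ c ∈ ℕ × Bool ]
      (∀ x y z → E G x y z → f x < f y → f y < f z → φ (f x) (f y) (f z) ≡ c)

{-# OPTIONS --safe #-}
module Submission where

-- If f embeds G monochromatically with colour (t, s), then
-- D(i, j) = δ(f i, f j) is an ultrametric on V(G); we induct on |V(G)|.
-- Let M be the largest distance. If some D(v, w) differs from M above
-- bit t, the vertices that are w or whose distance to w differs from M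
-- above bit t form a collapsible set in which w stands in for every member.
-- Otherwise all distances agree with M above bit t, so bit t of D(i, j)
-- is monotone in D(i, j) and "bit t is 0" is an equivalence relation.
-- The colour puts the middle vertex of every edge in the class of the
-- top vertex and not of the bottom one (s = true), or the mirror image.
-- With w the largest (smallest) vertex, the complement U of the class of
-- w lies entirely below (above) that class, so every edge meets U once or
-- three times: U is collapsible or a transversal. Collapsing yields two
-- smaller monochromatic graphs, and the level in 𝒰 rises by one.

open import Defs
open import Data.Bool using (Bool; true; false)
open import Data.Empty using (⊥-elim)
open import Data.Fin using (Fin; zero; suc)
import Data.Fin.Properties as Fin
open import Data.Fin.Subset using (Subset; _∈_; _∉_; ∣_∣; ∁; _-_) renaming (⊥ to ∅)
open import Data.Fin.Subset.Properties
  using (_∈?_; ∣⊥∣≡0; ⊥⊆; ∉⊥; ∣⊤∣≡n; ⊆⊤; ∈⊤; ∣∁p∣≡n∸∣p∣; x∈∁p⇒x∉p; x∉p⇒x∈∁p;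
         p⊂q⇒∣p∣<∣q∣; x∈p∧x≢y⇒x∈p-y; x∈p⇒∣p-x∣<∣p∣)
open import Data.List using (List; allFin; cartesianProduct)
open import Data.List.Membership.Propositional.Properties using (∈-allFin; ∈-cartesianProduct⁺)
import Data.List.Relation.Unary.All as All
open import Data.Maybe using (Maybe; just; nothing)
open import Data.Maybe.Properties using (just-injective)
open import Data.Nat
open import Data.Nat.DivMod using (_/_; _%_; m≡m%n+[m/n]*n; m%n<n; m/n<m; m/n≤m; /-monoˡ-≤)
open import Data.Nat.Induction using (<-wellFounded)
open import Data.Nat.Properties
open import Data.List.Extrema ≤-totalOrder using (argmax; argmin; f[xs]≤f[argmax]; f[argmin]≤f[xs])
open import Data.Product using (_×_; _,_; proj₁; proj₂; Σ-syntax; ∃-syntax; map; map₂; uncurry)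
open import Data.Sum using (_⊎_; inj₁; inj₂; [_,_]′)
import Data.Sum as Sum
open import Data.Vec using (_∷_; here; there; lookup; tabulate)
import Data.Vec.Properties as Vec
open import Function.Base using (_∘_; id)
open import Function.Bundles using (mk⇔)
open import Function.Definitions using (Injective)
import Induction.WellFounded as WF
import Relation.Binary.Construct.On as On
open import Relation.Binary.Definitions using (tri<; tri≈; tri>)
open import Relation.Binary.PropositionalEquality
open import Relation.Nullary using (¬_; Dec; yes; no; does)
open import Relation.Nullary.Decidable using (dec-true; decidable-stable; ¬?; _⊎-dec_; _×-dec_)
open import Relation.Unary using (Decidable)

bit-of-0 : ∀ i → bit 0 i ≡ 0
bit-of-0 zero    = refl
bit-of-0 (suc i) = bit-of-0 i

bit-vanishes : ∀ x i → x < i → bit x i ≡ 0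
bit-vanishes zero    i       _         = bit-of-0 i
bit-vanishes (suc x) (suc i) (s≤s x<i) =
  bit-vanishes (suc x / 2) i (<-≤-trans (m/n<m (suc x) 2 (s≤s (s≤s z≤n))) x<i)

bit-binary : ∀ x i → bit x i ≡ 0 ⊎ bit x i ≡ 1
bit-binary x (suc i) = bit-binary (x / 2) i
bit-binary x zero with x % 2 | m%n<n x 2
... | 0           | _                 = inj₁ refl
... | 1           | _                 = inj₂ refl
... | suc (suc _) | s≤s (s≤s ())

x≡bit₀+half*2 : ∀ x → x ≡ bit x 0 + (x / 2) * 2
x≡bit₀+half*2 x = m≡m%n+[m/n]*n x 2

bit-ext : ∀ x y → (∀ i → bit x i ≡ bit y i) → x ≡ y
bit-ext x y = go (x + y) x y ≤-refl
  where
  halves-smaller : ∀ k x y → x + y ≤ suc k → x / 2 + y / 2 ≤ k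
  halves-smaller k zero    zero    _ = z≤n
  halves-smaller k (suc x) y       h =
    ≤-pred (≤-trans (+-mono-<-≤ (m/n<m (suc x) 2 (s≤s (s≤s z≤n))) (m/n≤m y 2)) h)
  halves-smaller k zero    (suc y) h = ≤-pred (≤-trans (m/n<m (suc y) 2 (s≤s (s≤s z≤n))) h)

  go : ∀ k x y → x + y ≤ k → (∀ i → bit x i ≡ bit y i) → x ≡ y
  go zero    zero    zero    _ _  = refl
  go (suc k) x       y       h eq = begin
    x                     ≡⟨ x≡bit₀+half*2 x ⟩
    bit x 0 + (x / 2) * 2 ≡⟨ cong₂ (λ b r → b + r * 2) (eq 0)
                               (go k (x / 2) (y / 2) (halves-smaller k x y h) (eq ∘ suc)) ⟩
    bit y 0 + (y / 2) * 2 ≡⟨ x≡bit₀+half*2 y ⟨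
    y                     ∎
    where open ≡-Reasoning

bits-decide-< : ∀ d x y → (∀ i → d < i → bit x i ≡ bit y i) →
                bit x d ≡ 0 → bit y d ≡ 1 → x < y
bits-decide-< zero x y above bx by = begin-strict
  x                     ≡⟨ x≡bit₀+half*2 x ⟩
  bit x 0 + (x / 2) * 2 ≡⟨ cong₂ (λ b h → b + h * 2) bx
                             (bit-ext (x / 2) (y / 2) (λ i → above (suc i) (s≤s z≤n))) ⟩
  0 + (y / 2) * 2       <⟨ +-monoˡ-< ((y / 2) * 2) {0} {1} (s≤s z≤n) ⟩
  1 + (y / 2) * 2       ≡⟨ cong (λ b → b + (y / 2) * 2) by ⟨
  bit y 0 + (y / 2) * 2 ≡⟨ x≡bit₀+half*2 y ⟨
  y                     ∎
  where open ≤-Reasoning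
bits-decide-< (suc d) x y above bx by =
  ≰⇒> λ y≤x → <⇒≱ halves-< (/-monoˡ-≤ 2 y≤x)
  where
  halves-< : x / 2 < y / 2
  halves-< = bits-decide-< d (x / 2) (y / 2) (λ i d<i → above (suc i) (s≤s d<i)) bx by

-- The ultrametric δ

private
  δf-bit-above : ∀ k x y i → δf k x y < i → i < k → bit x i ≡ bit y i
  δf-bit-above (suc k) x y i δ<i i<1+k with bit x k ≟ bit y k
  ... | no _ = ⊥-elim (<⇒≱ δ<i (≤-pred i<1+k))
  ... | yes same with i ≟ k
  ...   | yes refl = same
  ...   | no  i≢k  = δf-bit-above k x y i δ<i (≤∧≢⇒< (≤-pred i<1+k) i≢k)

  δf-bit-below : ∀ k x y → bit x (δf k x y) ≡ bit y (δf k x y) →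
                 ∀ i → i < k → bit x i ≡ bit y i
  δf-bit-below (suc k) x y at i i<1+k with bit x k ≟ bit y k
  ... | no differ = ⊥-elim (differ at)
  ... | yes same with i ≟ k
  ...   | yes refl = same
  ...   | no  i≢k  = δf-bit-below k x y at i (≤∧≢⇒< (≤-pred i<1+k) i≢k)

  δf≤ : ∀ k x y → δf (suc k) x y ≤ k
  δf≤ k x y with bit x k ≟ bit y k
  δf≤ k       x y | no  _ = ≤-refl
  δf≤ zero    x y | yes _ = z≤n
  δf≤ (suc k) x y | yes _ = m≤n⇒m≤1+n (δf≤ k x y)

  δf-sym : ∀ k x y → δf k x y ≡ δf k y x
  δf-sym zero    x y = refl
  δf-sym (suc k) x y with bit x k ≟ bit y k | bit y k ≟ bit x k
  ... | yes _ | yes _ = δf-sym k x y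
  ... | no  _ | no  _ = refl
  ... | yes p | no  q = ⊥-elim (q (sym p))
  ... | no  p | yes q = ⊥-elim (p (sym q))

  δf-self : ∀ k x → δf k x x ≡ 0
  δf-self zero    x = refl
  δf-self (suc k) x with bit x k ≟ bit x k
  ... | yes _ = δf-self k x
  ... | no  q = ⊥-elim (q refl)

bit-above-δ : ∀ x y i → δ x y < i → bit x i ≡ bit y i
bit-above-δ x y i δ<i with i <? suc (x + y)
... | yes i≤x+y = δf-bit-above (suc (x + y)) x y i δ<i i≤x+y
... | no  i≰x+y = trans (bit-vanishes x i (≤-<-trans (m≤m+n x y) x+y<i))
                        (sym (bit-vanishes y i (≤-<-trans (m≤n+m y x) x+y<i)))
  where x+y<i : x + y < i
        x+y<i = ≮⇒≥ i≰x+y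

bit-at-δ : ∀ x y → x ≢ y → bit x (δ x y) ≢ bit y (δ x y)
bit-at-δ x y x≢y at = x≢y (bit-ext x y agree)
  where
  agree : ∀ i → bit x i ≡ bit y i
  agree i with i <? suc (x + y)
  ... | yes i≤x+y = δf-bit-below (suc (x + y)) x y at i i≤x+y
  ... | no  i≰x+y = bit-above-δ x y i (<-≤-trans (s≤s (δf≤ (x + y) x y)) (≮⇒≥ i≰x+y))

δ-sym : ∀ x y → δ x y ≡ δ y x
δ-sym x y rewrite +-comm x y = δf-sym (suc (y + x)) x y

δ-self : ∀ x → δ x x ≡ 0
δ-self x = δf-self (suc (x + x)) x

differing-bit≤δ : ∀ x y d → bit x d ≢ bit y d → d ≤ δ x y
differing-bit≤δ x y d differ = ≮⇒≥ (differ ∘ bit-above-δ x y d)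

δ-ultra : ∀ x y z → δ x z ≤ δ x y ⊔ δ y z
δ-ultra x y z = ≮⇒≥ far
  where
  far : ¬ (δ x y ⊔ δ y z < δ x z)
  far lt with x ≟ z
  ... | yes refl = <⇒≱ lt (subst (_≤ δ x y ⊔ δ y x) (sym (δ-self x)) z≤n)
  ... | no  x≢z  = bit-at-δ x z x≢z
    (trans (bit-above-δ x y _ (≤-<-trans (m≤m⊔n _ _) lt))
           (bit-above-δ y z _ (≤-<-trans (m≤n⊔m _ _) lt)))

bits-at-δ-< : ∀ x y → x < y → bit x (δ x y) ≡ 0 × bit y (δ x y) ≡ 1
bits-at-δ-< x y x<y with bit-binary x (δ x y) | bit-binary y (δ x y)
... | inj₁ bx | inj₂ by = bx , by
... | inj₁ bx | inj₁ by = ⊥-elim (bit-at-δ x y (<⇒≢ x<y) (trans bx (sym by)))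
... | inj₂ bx | inj₂ by = ⊥-elim (bit-at-δ x y (<⇒≢ x<y) (trans bx (sym by)))
... | inj₂ bx | inj₁ by =
  ⊥-elim (<-asym x<y (bits-decide-< (δ x y) y x (λ i lt → sym (bit-above-δ x y i lt)) by bx))

δ-monoʳ : ∀ x y z → x < y → y ≤ z → δ x y ≤ δ x z
δ-monoʳ x y z x<y y≤z = ≮⇒≥ λ lt → <⇒≱ (z<y lt) y≤z
  where
  d : ℕ
  d = δ x y
  z<y : δ x z < d → z < y
  z<y lt = bits-decide-< d z y above
             (trans (sym (bit-above-δ x z d lt)) (proj₁ (bits-at-δ-< x y x<y)))
             (proj₂ (bits-at-δ-< x y x<y))
    where
    above : ∀ i → d < i → bit z i ≡ bit y i
    above i d<i = trans (sym (bit-above-δ x z i (<-trans lt d<i))) (bit-above-δ x y i d<i)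

δ-antimonoˡ : ∀ x y z → x ≤ y → y < z → δ y z ≤ δ x z
δ-antimonoˡ x y z x≤y y<z = ≮⇒≥ λ lt → <⇒≱ (y<x lt) x≤y
  where
  d : ℕ
  d = δ y z
  y<x : δ x z < d → y < x
  y<x lt = bits-decide-< d y x above
             (proj₁ (bits-at-δ-< y z y<z))
             (trans (bit-above-δ x z d lt) (proj₂ (bits-at-δ-< y z y<z)))
    where
    above : ∀ i → d < i → bit y i ≡ bit x i
    above i d<i = trans (bit-above-δ y z i d<i) (sym (bit-above-δ x z i (<-trans lt d<i)))

δ-isosceles : ∀ p p' y → δ p p' < δ p y → δ p' y ≡ δ p y
δ-isosceles p p' y lt = ≤-antisym upper lower
  where
  upper : δ p' y ≤ δ p y
  upper = ≤-trans (δ-ultra p' p y)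
            (≤-reflexive (trans (cong (_⊔ δ p y) (δ-sym p' p)) (m≤n⇒m⊔n≡n (<⇒≤ lt))))
  lower : δ p y ≤ δ p' y
  lower = ≮⇒≥ λ lt' → <⇒≱ (⊔-lub lt lt') (δ-ultra p p' y)

<-transfer : ∀ p p' y → δ p p' < δ p y → p < y → p' < y
<-transfer p p' y lt p<y =
  bits-decide-< d p' y above (trans (sym (bit-above-δ p p' d lt)) (proj₁ bits)) (proj₂ bits)
  where
  d : ℕ
  d = δ p y
  bits : bit p d ≡ 0 × bit y d ≡ 1
  bits = bits-at-δ-< p y p<y
  above : ∀ i → d < i → bit p' i ≡ bit y i
  above i d<i = bit-above-δ p' y i (subst (_< i) (sym (δ-isosceles p p' y lt)) d<i)

δ-consecutive-≢ : ∀ x y z → x < y → y < z → δ x y ≢ δ y z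
δ-consecutive-≢ x y z x<y y<z e =
  0≢1+n (trans (sym (subst (λ d → bit y d ≡ 0) (sym e) (proj₁ (bits-at-δ-< y z y<z))))
               (proj₂ (bits-at-δ-< x y x<y)))

-- Agreement above a position

Agree : ℕ → ℕ → ℕ → Set
Agree t a b = δ a b ≤ t

agree-refl : ∀ {t} a → Agree t a a
agree-refl a = subst (_≤ _) (sym (δ-self a)) z≤n

agree-sym : ∀ {t} a b → Agree t a b → Agree t b a
agree-sym a b = subst (_≤ _) (δ-sym a b)

agree-trans : ∀ {t} a b c → Agree t a b → Agree t b c → Agree t a c
agree-trans a b c ab bc = ≤-trans (δ-ultra a b c) (⊔-lub ab bc)

agree-convex : ∀ {t} ℓ m M → ℓ ≤ m → m ≤ M → Agree t ℓ M → Agree t m M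
agree-convex ℓ m M ℓ≤m m≤M ℓM with m≤n⇒m<n∨m≡n m≤M
... | inj₁ m<M  = ≤-trans (δ-antimonoˡ ℓ m M ℓ≤m m<M) ℓM
... | inj₂ refl = agree-refl m

agree-⊔ : ∀ {t} a b c M → a ≤ b ⊔ c → b ⊔ c ≤ M → Agree t a M → Agree t b M ⊎ Agree t c M
agree-⊔ {t} a b c M a≤b⊔c b⊔c≤M aM = Sum.map transport transport (⊔-sel b c)
  where
  transport : ∀ {x} → b ⊔ c ≡ x → Agree t x M
  transport e = subst (λ x → Agree t x M) e (agree-convex a (b ⊔ c) M a≤b⊔c b⊔c≤M aM)

agree-bit-mono : ∀ {t} a b → Agree t a b → a ≤ b → bit a t ≡ 1 → bit b t ≡ 1
agree-bit-mono a b ab a≤b ba with m≤n⇒m<n∨m≡n a≤b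
... | inj₂ refl = ba
... | inj₁ a<b with m≤n⇒m<n∨m≡n ab
...   | inj₁ δ<t = trans (sym (bit-above-δ a b _ δ<t)) ba
...   | inj₂ refl = proj₂ (bits-at-δ-< a b a<b)

agree-split : ∀ {t} a b → Agree t a b → bit a t ≡ 1 → bit b t ≡ 0 → δ a b ≡ t × b < a
agree-split {t} a b ab ba bb = δab≡t , b<a
  where
  δab≡t : δ a b ≡ t
  δab≡t = ≤-antisym ab (differing-bit≤δ a b t λ e → 0≢1+n (trans (sym bb) (trans (sym e) ba)))
  b<a : b < a
  b<a = bits-decide-< t b a
          (λ i t<i → bit-above-δ b a i (subst (_< i) (sym (trans (δ-sym b a) δab≡t)) t<i)) bb ba

enumerate : ∀ {m} (p : Subset m) → Fin ∣ p ∣ → Fin m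
enumerate (true  ∷ p) zero    = zero
enumerate (true  ∷ p) (suc i) = suc (enumerate p i)
enumerate (false ∷ p) i       = suc (enumerate p i)

enumerate-∈ : ∀ {m} (p : Subset m) i → enumerate p i ∈ p
enumerate-∈ (true  ∷ p) zero    = here
enumerate-∈ (true  ∷ p) (suc i) = there (enumerate-∈ p i)
enumerate-∈ (false ∷ p) i       = there (enumerate-∈ p i)

enumerate-injective : ∀ {m} (p : Subset m) → Injective _≡_ _≡_ (enumerate p)
enumerate-injective (true  ∷ p) {zero}  {zero}  _ = refl
enumerate-injective (true  ∷ p) {suc i} {suc j} e =
  cong suc (enumerate-injective p (Fin.suc-injective e))
enumerate-injective (false ∷ p)                 e = enumerate-injective p (Fin.suc-injective e)

enumerate-surjective : ∀ {m} (p : Subset m) x → x ∈ p → ∃[ i ] enumerate p i ≡ x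
enumerate-surjective (true  ∷ p) zero    here      = zero , refl
enumerate-surjective (true  ∷ p) (suc x) (there h) = map suc (cong suc) (enumerate-surjective p x h)
enumerate-surjective (false ∷ p) (suc x) (there h) = map₂ (cong suc) (enumerate-surjective p x h)

0<∣p∣ : ∀ {m} {p : Subset m} {x} → x ∈ p → 0 < ∣ p ∣
0<∣p∣ {m} {p} {x} x∈p = subst (_< ∣ p ∣) (∣⊥∣≡0 m) (p⊂q⇒∣p∣<∣q∣ (⊥⊆ , x , x∈p , ∉⊥))

2≤∣p∣ : ∀ {m} {p : Subset m} {x y} → x ∈ p → y ∈ p → x ≢ y → 2 ≤ ∣ p ∣
2≤∣p∣ x∈p y∈p x≢y = ≤-<-trans (0<∣p∣ (x∈p∧x≢y⇒x∈p-y y∈p (x≢y ∘ sym))) (x∈p⇒∣p-x∣<∣p∣ x∈p)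

∣p∣<n : ∀ {m} {p : Subset m} {x} → x ∉ p → ∣ p ∣ < m
∣p∣<n {m} {p} {x} x∉p = subst (∣ p ∣ <_) (∣⊤∣≡n m) (p⊂q⇒∣p∣<∣q∣ (⊆⊤ , x , ∈⊤ , x∉p))

module _ {m} {P : Fin m → Set} (P? : Decidable P) where

  subsetOf : Subset m
  subsetOf = tabulate (does ∘ P?)

  ∈subsetOf⁺ : ∀ {u} → P u → u ∈ subsetOf
  ∈subsetOf⁺ {u} pu = Vec.lookup⇒[]= u subsetOf
    (trans (Vec.lookup∘tabulate (does ∘ P?) u) (dec-true (P? u) pu))

  ∈subsetOf⁻ : ∀ {u} → u ∈ subsetOf → P u
  ∈subsetOf⁻ {u} u∈ with P? u | trans (sym (Vec.lookup∘tabulate (does ∘ P?) u)) (Vec.[]=⇒lookup u∈)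
  ... | yes pu | _ = pu

private
  weight : ∀ {m} {U : Subset m} {x} → Dec (x ∈ U) → ℕ
  weight (yes _) = 1
  weight (no  _) = 0

  b2n≡weight : ∀ {m} (U : Subset m) x → b2n (lookup U x) ≡ weight (x ∈? U)
  b2n≡weight U x with x ∈? U
  ... | yes x∈U = cong b2n (Vec.[]=⇒lookup x∈U)
  ... | no  x∉U with lookup U x in e
  ...   | true  = ⊥-elim (x∉U (Vec.lookup⇒[]= x U e))
  ...   | false = refl

  count3≡weights : ∀ {m} (U : Subset m) x y z →
                   count3 U x y z ≡ weight (x ∈? U) + weight (y ∈? U) + weight (z ∈? U)
  count3≡weights U x y z = cong₂ _+_ (cong₂ _+_ (b2n≡weight U x) (b2n≡weight U y)) (b2n≡weight U z)

count3-swap₁₂ : ∀ {m} (U : Subset m) x y z → count3 U x y z ≡ count3 U y x z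
count3-swap₁₂ U x y z = cong (_+ b2n (lookup U z)) (+-comm (b2n (lookup U x)) _)

count3-swap₂₃ : ∀ {m} (U : Subset m) x y z → count3 U x y z ≡ count3 U x z y
count3-swap₂₃ U x y z = begin
  b2n (lookup U x) + b2n (lookup U y) + b2n (lookup U z)   ≡⟨ +-assoc (b2n (lookup U x)) _ _ ⟩
  b2n (lookup U x) + (b2n (lookup U y) + b2n (lookup U z)) ≡⟨ cong (b2n (lookup U x) +_)
                                                                (+-comm (b2n (lookup U y)) _) ⟩
  b2n (lookup U x) + (b2n (lookup U z) + b2n (lookup U y)) ≡⟨ +-assoc (b2n (lookup U x)) _ _ ⟨
  b2n (lookup U x) + b2n (lookup U z) + b2n (lookup U y)   ∎
  where open ≡-Reasoning

count3≡2⇒ : ∀ {m} (U : Subset m) x y z → count3 U x y z ≡ 2 →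
            (x ∈ U × y ∈ U × z ∉ U) ⊎ (x ∈ U × y ∉ U × z ∈ U) ⊎ (x ∉ U × y ∈ U × z ∈ U)
count3≡2⇒ U x y z two with x ∈? U | y ∈? U | z ∈? U | trans (sym (count3≡weights U x y z)) two
... | yes a | yes b | no  c | _ = inj₁ (a , b , c)
... | yes a | no  b | yes c | _ = inj₂ (inj₁ (a , b , c))
... | no  a | yes b | yes c | _ = inj₂ (inj₂ (a , b , c))
... | yes _ | yes _ | yes _ | ()
... | yes _ | no  _ | no  _ | ()
... | no  _ | yes _ | no  _ | ()
... | no  _ | no  _ | yes _ | ()
... | no  _ | no  _ | no  _ | ()

count3≡1 : ∀ {m} (U : Subset m) x y z → count3 U x y z ≢ 2 →
           ¬ (x ∈ U × y ∈ U × z ∈ U) → ¬ (x ∉ U × y ∉ U × z ∉ U) → count3 U x y z ≡ 1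
count3≡1 U x y z ≢2 ¬all ¬none =
  trans (count3≡weights U x y z)
        (by-cases (x ∈? U) (y ∈? U) (z ∈? U) (≢2 ∘ trans (count3≡weights U x y z)))
  where
  by-cases : (a : Dec (x ∈ U)) (b : Dec (y ∈ U)) (c : Dec (z ∈ U)) →
             weight a + weight b + weight c ≢ 2 → weight a + weight b + weight c ≡ 1
  by-cases (yes _) (no  _) (no  _) _  = refl
  by-cases (no  _) (yes _) (no  _) _  = refl
  by-cases (no  _) (no  _) (yes _) _  = refl
  by-cases (yes a) (yes b) (yes c) _  = ⊥-elim (¬all (a , b , c))
  by-cases (no  a) (no  b) (no  c) _  = ⊥-elim (¬none (a , b , c))
  by-cases (yes _) (yes _) (no  _) ≢2 = ⊥-elim (≢2 refl)
  by-cases (yes _) (no  _) (yes _) ≢2 = ⊥-elim (≢2 refl)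
  by-cases (no  _) (yes _) (yes _) ≢2 = ⊥-elim (≢2 refl)

maximiser : ∀ {m} → Fin m → (g : Fin m → ℕ) → ∃[ i ] (∀ j → g j ≤ g i)
maximiser {m} x₀ g =
  argmax g x₀ (allFin m) , λ j → All.lookup (f[xs]≤f[argmax] x₀ (allFin m)) (∈-allFin j)

minimiser : ∀ {m} → Fin m → (g : Fin m → ℕ) → ∃[ i ] (∀ j → g i ≤ g j)
minimiser {m} x₀ g =
  argmin g x₀ (allFin m) , λ j → All.lookup (f[argmin]≤f[xs] x₀ (allFin m)) (∈-allFin j)

pair-maximiser : ∀ {m} → Fin m → (g : Fin m → Fin m → ℕ) →
                 ∃[ ij ] (∀ k l → g k l ≤ uncurry g ij)
pair-maximiser {m} x₀ g =
  argmax (uncurry g) (x₀ , x₀) pairs ,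
  λ k l → All.lookup (f[xs]≤f[argmax] (x₀ , x₀) pairs) (∈-cartesianProduct⁺ (∈-allFin k) (∈-allFin l))
  where pairs : List (Fin m × Fin m)
        pairs = cartesianProduct (allFin m) (allFin m)

inhabited? : ∀ m → Fin m ⊎ ¬ Fin m
inhabited? zero    = inj₂ λ ()
inhabited? (suc m) = inj₁ zero

gtB-true⁻ : ∀ a b → gtB a b ≡ true → b < a
gtB-true⁻ a b e with b <? a
... | yes b<a = b<a

gtB-false⁻ : ∀ a b → gtB a b ≡ false → ¬ b < a
gtB-false⁻ a b e with b <? a
... | no b≮a = b≮a

gtB-true⁺ : ∀ a b → b < a → gtB a b ≡ true
gtB-true⁺ a b b<a with b <? a
... | yes _   = refl
... | no b≮a = ⊥-elim (b≮a b<a)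

gtB-false⁺ : ∀ a b → ¬ b < a → gtB a b ≡ false
gtB-false⁺ a b b≮a with b <? a
... | yes b<a = ⊥-elim (b≮a b<a)
... | no _    = refl

module _ (G : Graph3) (f : Fin (n G) → ℕ) (f-inj : Injective _≡_ _≡_ f) where

  sorted-edge-elim : (Q : Fin (n G) → Fin (n G) → Fin (n G) → Set) →
    (∀ {x y z} → Q x y z → Q y x z) → (∀ {x y z} → Q x y z → Q x z y) →
    (∀ x y z → E G x y z → f x < f y → f y < f z → Q x y z) →
    ∀ x y z → E G x y z → Q x y z
  sorted-edge-elim Q s₁₂ s₂₃ sorted x y z e with E-distinct G e
  ... | x≢y , y≢z , x≢z with <-cmp (f x) (f y) | <-cmp (f y) (f z) | <-cmp (f x) (f z)
  ... | tri≈ _ q _ | _          | _          = ⊥-elim (x≢y (f-inj q))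
  ... | _          | tri≈ _ q _ | _          = ⊥-elim (y≢z (f-inj q))
  ... | _          | _          | tri≈ _ q _ = ⊥-elim (x≢z (f-inj q))
  ... | tri< a _ _ | tri< b _ _ | _          = sorted x y z e a b
  ... | tri< a _ _ | tri> _ _ b | tri< c _ _ = s₂₃ (sorted x z y (E-swap₂₃ G e) c b)
  ... | tri< a _ _ | tri> _ _ b | tri> _ _ c = s₂₃ (s₁₂ (sorted z x y (E-swap₁₂ G (E-swap₂₃ G e)) c a))
  ... | tri> _ _ a | tri< b _ _ | tri< c _ _ = s₁₂ (sorted y x z (E-swap₁₂ G e) a c)
  ... | tri> _ _ a | tri< b _ _ | tri> _ _ c = s₁₂ (s₂₃ (sorted y z x (E-swap₂₃ G (E-swap₁₂ G e)) b c))
  ... | tri> _ _ a | tri> _ _ b | _          =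
    s₁₂ (s₂₃ (s₁₂ (sorted z y x (E-swap₁₂ G (E-swap₂₃ G (E-swap₁₂ G e))) b a)))

Monochromatic : (G : Graph3) → (Fin (n G) → ℕ) → ℕ × Bool → Set
Monochromatic G f c = ∀ x y z → E G x y z → f x < f y → f y < f z → φ (f x) (f y) (f z) ≡ c

MonoEmbedding : Graph3 → Set
MonoEmbedding G = Σ[ f ∈ (Fin (n G) → ℕ) ] Injective _≡_ _≡_ f × Σ[ c ∈ ℕ × Bool ] Monochromatic G f c

-- The vertex v* of the collapsed graph is embedded at rep, which must
-- therefore be able to replace any vertex of U in an edge meeting U once.
Represents : (G : Graph3) → (Fin (n G) → ℕ) → ℕ × Bool → Subset (n G) → Fin (n G) → Set
Represents G f c U rep = ∀ u y z → u ∈ U → y ∉ U → z ∉ U → E G y z u →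
    (f rep < f y → f y < f z → φ (f rep) (f y) (f z) ≡ c)
  × (f y < f rep → f rep < f z → φ (f y) (f rep) (f z) ≡ c)
  × (f y < f z → f z < f rep → φ (f y) (f z) (f rep) ≡ c)

module _ (G : Graph3) (U : Subset (n G)) where

  private
    just≢nothing : ∀ {A : Set} {x : A} → just x ≢ nothing
    just≢nothing ()

  collapseEdge-distinct : ∀ a b c → CollapseEdge G U a b c → a ≢ b × b ≢ c × a ≢ c
  collapseEdge-distinct (just x) (just y) (just z) (e , _) with E-distinct G e
  ... | x≢y , y≢z , x≢z = x≢y ∘ just-injective , y≢z ∘ just-injective , x≢z ∘ just-injective
  collapseEdge-distinct nothing  (just y) (just z) (_ , _ , e) with E-distinct G e
  ... | y≢z , _ , _ = just≢nothing ∘ sym , y≢z ∘ just-injective , just≢nothing ∘ sym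
  collapseEdge-distinct (just x) nothing  (just z) (_ , _ , e) with E-distinct G e
  ... | x≢z , _ , _ = just≢nothing , just≢nothing ∘ sym , x≢z ∘ just-injective
  collapseEdge-distinct (just x) (just y) nothing  (_ , _ , e) with E-distinct G e
  ... | x≢y , _ , _ = x≢y ∘ just-injective , just≢nothing , just≢nothing

  collapseEdge-swap₁₂ : ∀ a b c → CollapseEdge G U a b c → CollapseEdge G U b a c
  collapseEdge-swap₁₂ (just x) (just y) (just z) (e , x∉ , y∉ , z∉) = E-swap₁₂ G e , y∉ , x∉ , z∉
  collapseEdge-swap₁₂ nothing  (just y) (just z) h                  = h
  collapseEdge-swap₁₂ (just x) nothing  (just z) h                  = h
  collapseEdge-swap₁₂ (just x) (just y) nothing  (u , u∈ , e)       = u , u∈ , E-swap₁₂ G e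

  collapseEdge-swap₂₃ : ∀ a b c → CollapseEdge G U a b c → CollapseEdge G U a c b
  collapseEdge-swap₂₃ (just x) (just y) (just z) (e , x∉ , y∉ , z∉) = E-swap₂₃ G e , x∉ , z∉ , y∉
  collapseEdge-swap₂₃ nothing  (just y) (just z) (u , u∈ , e)       = u , u∈ , E-swap₁₂ G e
  collapseEdge-swap₂₃ (just x) nothing  (just z) h                  = h
  collapseEdge-swap₂₃ (just x) (just y) nothing  h                  = h

module Collapse (G : Graph3) (U : Subset (n G)) (U-collapsible : Collapsible G U) where

  private
    member : Fin ∣ U ∣ → Fin (n G)
    member = enumerate U

    outsider : Fin ∣ ∁ U ∣ → Fin (n G)
    outsider = enumerate (∁ U)

    outsider-∉ : ∀ i → outsider i ∉ U
    outsider-∉ i = x∈∁p⇒x∉p (enumerate-∈ (∁ U) i)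

    vertex : Fin (suc ∣ ∁ U ∣) → Maybe (Fin (n G))
    vertex zero    = nothing
    vertex (suc i) = just (outsider i)

    vertex-injective : Injective _≡_ _≡_ vertex
    vertex-injective {zero}  {zero}  _ = refl
    vertex-injective {suc i} {suc j} e = cong suc (enumerate-injective (∁ U) (just-injective e))

  induced : Graph3
  induced = record
    { n          = ∣ U ∣
    ; E          = λ a b c → E G (member a) (member b) (member c)
    ; E-distinct = λ e → map (_∘ cong member) (map (_∘ cong member) (_∘ cong member)) (E-distinct G e)
    ; E-swap₁₂   = E-swap₁₂ G
    ; E-swap₂₃   = E-swap₂₃ G
    }

  collapsed : Graph3
  collapsed = record
    { n          = suc ∣ ∁ U ∣
    ; E          = λ a b c → CollapseEdge G U (vertex a) (vertex b) (vertex c)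
    ; E-distinct = λ {a} {b} {c} e →
        map (_∘ cong vertex) (map (_∘ cong vertex) (_∘ cong vertex))
            (collapseEdge-distinct G U (vertex a) (vertex b) (vertex c) e)
    ; E-swap₁₂   = λ {a} {b} {c} → collapseEdge-swap₁₂ G U (vertex a) (vertex b) (vertex c)
    ; E-swap₂₃   = λ {a} {b} {c} → collapseEdge-swap₂₃ G U (vertex a) (vertex b) (vertex c)
    }

  reducible : Reducible G collapsed induced
  reducible = U , U-collapsible , iso-collapse , iso-induced
    where
    iso-collapse : IsoCollapse G U collapsed
    iso-collapse = vertex , vertex-injective , vertex-cases , (zero , refl) , vertex-onto ,
                   λ _ _ _ → mk⇔ id id
      where
      vertex-cases : ∀ w → vertex w ≡ nothing ⊎ ∃[ v ] (vertex w ≡ just v × v ∉ U)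
      vertex-cases zero    = inj₁ refl
      vertex-cases (suc i) = inj₂ (outsider i , refl , outsider-∉ i)
      vertex-onto : ∀ v → v ∉ U → ∃[ w ] vertex w ≡ just v
      vertex-onto v v∉U =
        map suc (cong just) (enumerate-surjective (∁ U) v (x∉p⇒x∈∁p v∉U))

    iso-induced : IsoInduced G U induced
    iso-induced = member , enumerate-injective U , enumerate-∈ U , enumerate-surjective U ,
                  λ _ _ _ → mk⇔ id id

  induced-smaller : n induced < n G
  induced-smaller = proj₁ (proj₂ U-collapsible)

  collapsed-smaller : n collapsed < n G
  collapsed-smaller = begin-strict
    suc ∣ ∁ U ∣            ≡⟨ cong suc (∣∁p∣≡n∸∣p∣ U) ⟩
    suc (n G ∸ ∣ U ∣)      <⟨ +-monoˡ-≤ (n G ∸ ∣ U ∣) (proj₁ U-collapsible) ⟩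
    ∣ U ∣ + (n G ∸ ∣ U ∣)  ≡⟨ m+[n∸m]≡n (<⇒≤ induced-smaller) ⟩
    n G                    ∎
    where open ≤-Reasoning

  module _ (f : Fin (n G) → ℕ) (f-inj : Injective _≡_ _≡_ f)
           (c : ℕ × Bool) (mono : Monochromatic G f c) where

    induced-embedding : MonoEmbedding induced
    induced-embedding = f ∘ member , enumerate-injective U ∘ f-inj , c ,
                        λ x y z → mono (member x) (member y) (member z)

    collapsed-embedding : ∀ rep → rep ∈ U → Represents G f c U rep → MonoEmbedding collapsed
    collapsed-embedding rep rep∈U represents = g , g-injective , c , g-mono
      where
      g : Fin (suc ∣ ∁ U ∣) → ℕ
      g zero    = f rep
      g (suc i) = f (outsider i)

      g-injective : Injective _≡_ _≡_ g
      g-injective {zero}  {zero}  _ = refl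
      g-injective {zero}  {suc j} e = ⊥-elim (outsider-∉ j (subst (_∈ U) (f-inj e) rep∈U))
      g-injective {suc i} {zero}  e = ⊥-elim (outsider-∉ i (subst (_∈ U) (f-inj (sym e)) rep∈U))
      g-injective {suc i} {suc j} e = cong suc (enumerate-injective (∁ U) (f-inj e))

      g-mono : Monochromatic collapsed g c
      g-mono (suc a) (suc b) (suc d) (e , _)       = mono (outsider a) (outsider b) (outsider d) e
      g-mono zero    (suc b) (suc d) (u , u∈U , e) =
        proj₁ (represents u _ _ u∈U (outsider-∉ b) (outsider-∉ d) e)
      g-mono (suc a) zero    (suc d) (u , u∈U , e) =
        proj₁ (proj₂ (represents u _ _ u∈U (outsider-∉ a) (outsider-∉ d) e))
      g-mono (suc a) (suc b) zero    (u , u∈U , e) =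
        proj₂ (proj₂ (represents u _ _ u∈U (outsider-∉ a) (outsider-∉ b) e))

𝒰⁺ : Graph3 → Set₁
𝒰⁺ G = Σ[ k ∈ ℕ ] InU (suc k) G

InU-lift : ∀ {a b G} → a ≤′ b → InU (suc a) G → InU (suc b) G
InU-lift ≤′-refl        p = p
InU-lift (≤′-step a≤b) p = old (InU-lift a≤b p)

𝒰⁺-reduce : ∀ {G} H F → Reducible G H F → 𝒰⁺ H → 𝒰⁺ F → 𝒰⁺ G
𝒰⁺-reduce H F r (kH , H∈) (kF , F∈) =
  suc (kH ⊔ kF) ,
  red H F r (InU-lift (≤⇒≤′ (m≤m⊔n kH kF)) H∈) (InU-lift (≤⇒≤′ (≤-trans (m≤n⊔m kH kF) (n≤1+n _))) F∈)

-- The inductive step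

module Step (G : Graph3) (f : Fin (n G) → ℕ) (f-inj : Injective _≡_ _≡_ f)
            (t : ℕ) (s : Bool) (mono : Monochromatic G f (t , s))
            (ih : ∀ {H} → n H < n G → MonoEmbedding H → 𝒰⁺ H) where

  V : Set
  V = Fin (n G)

  D : V → V → ℕ
  D i j = δ (f i) (f j)

  D-sym : ∀ i j → D i j ≡ D j i
  D-sym i j = δ-sym (f i) (f j)

  <ᶠ⇒≢ : ∀ {x y} → f x < f y → x ≢ y
  <ᶠ⇒≢ x<y refl = <-irrefl refl x<y

  edge-δ : ∀ {x y z} → E G x y z → f x < f y → f y < f z → δ (D x y) (D y z) ≡ t
  edge-δ e x<y y<z = cong proj₁ (mono _ _ _ e x<y y<z)

  edge-gtB : ∀ {x y z} → E G x y z → f x < f y → f y < f z → gtB (D x y) (D y z) ≡ s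
  edge-gtB e x<y y<z = cong proj₂ (mono _ _ _ e x<y y<z)

  edge-agree : ∀ {x y z} → E G x y z → f x < f y → f y < f z → Agree t (D x y) (D y z)
  edge-agree e x<y y<z = ≤-reflexive (edge-δ e x<y y<z)

  recolour : ∀ x y z x' y' z' → D x y ≡ D x' y' → D y z ≡ D y' z' →
             φ (f x') (f y') (f z') ≡ (t , s) → φ (f x) (f y) (f z) ≡ (t , s)
  recolour _ _ _ _ _ _ e₁ e₂ = trans (cong₂ (λ a b → δ a b , gtB a b) e₁ e₂)

  count3-sorted : (P : ℕ → Set) (U : Subset (n G)) →
    (∀ x y z → E G x y z → f x < f y → f y < f z → P (count3 U x y z)) →
    ∀ x y z → E G x y z → P (count3 U x y z)
  count3-sorted P U = sorted-edge-elim G f f-inj (λ x y z → P (count3 U x y z))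
    (λ {x} {y} {z} → subst P (count3-swap₁₂ U x y z)) (λ {x} {y} {z} → subst P (count3-swap₂₃ U x y z))

  by-collapse : ∀ U → Collapsible G U → ∀ rep → rep ∈ U → Represents G f (t , s) U rep → 𝒰⁺ G
  by-collapse U U-collapsible rep rep∈U represents = 𝒰⁺-reduce collapsed induced reducible
    (ih collapsed-smaller (collapsed-embedding f f-inj _ mono rep rep∈U represents))
    (ih induced-smaller (induced-embedding f f-inj _ mono))
    where open Collapse G U U-collapsible

  by-transversal : ∀ U → (∀ x y z → E G x y z → count3 U x y z ≡ 1) → 𝒰⁺ G
  by-transversal U one = 0 , u₁ (U , one)

  module _ (M : ℕ) where

    Near : V → V → Set
    Near i j = Agree t (D i j) M

    near-sym : ∀ i j → Near i j → Near j i
    near-sym i j = subst (λ d → Agree t d M) (D-sym i j)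

    module _ (D≤M : ∀ i j → D i j ≤ M) where

      near-spread : ∀ i j k → Near i k → Near i j ⊎ Near j k
      near-spread i j k =
        agree-⊔ (D i k) (D i j) (D j k) M (δ-ultra (f i) (f j) (f k)) (⊔-lub (D≤M i j) (D≤M j k))

      module FarPair (p p' : V) (DpM : D p p' ≡ M) (v w : V) (v≢w : v ≢ w) (far : ¬ Near v w) where

        InS : V → Set
        InS u = u ≡ w ⊎ ¬ Near u w

        InS? : Decidable InS
        InS? u = (u Fin.≟ w) ⊎-dec ¬? (δ (D u w) M ≤? t)

        S : Subset (n G)
        S = subsetOf InS?

        ∉S⁻ : ∀ {y} → y ∉ S → ¬ InS y
        ∉S⁻ y∉S = y∉S ∘ ∈subsetOf⁺ InS?

        outside-near : ∀ {y} → ¬ InS y → Near y w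
        outside-near {y} y∉S = decidable-stable (δ (D y w) M ≤? t) (y∉S ∘ inj₂)

        S-separated : ∀ u u' → InS u → InS u' → u ≢ u' → ¬ Near u u'
        S-separated u u' (inj₁ refl) (inj₁ refl) u≢u' _  = u≢u' refl
        S-separated u u' (inj₁ refl) (inj₂ far') _    uu' = far' (near-sym u u' uu')
        S-separated u u' (inj₂ far)  (inj₁ refl) _    uu' = far uu'
        S-separated u u' (inj₂ far)  (inj₂ far') _    uu' =
          [ far , far' ∘ near-sym w u' ]′ (near-spread u w u' uu')

        S-near-outside : ∀ u y → InS u → ¬ InS y → Near u y
        S-near-outside u y (inj₁ refl) y∉S = near-sym y u (outside-near y∉S)
        S-near-outside u y (inj₂ far)  y∉S =
          [ near-sym y u , ⊥-elim ∘ far ]′ (near-spread y u w (outside-near y∉S))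

        S-far : ∀ u → InS u → u ≢ w → ¬ Near u w
        S-far u (inj₁ u≡w)  u≢w = ⊥-elim (u≢w u≡w)
        S-far u (inj₂ far') _   = far'

        outside-farther : ∀ u y → InS u → u ≢ w → ¬ InS y → D u w < D u y
        outside-farther u y u∈S u≢w y∉S = ≰⇒> λ Duy≤Duw →
          S-far u u∈S u≢w
            (agree-convex (D u y) (D u w) M Duy≤Duw (D≤M u w) (S-near-outside u y u∈S y∉S))

        outside-δ : ∀ u y → InS u → ¬ InS y → D w y ≡ D u y
        outside-δ u y u∈S y∉S with u Fin.≟ w
        ... | yes refl = refl
        ... | no  u≢w  = δ-isosceles (f u) (f w) (f y) (outside-farther u y u∈S u≢w y∉S)

        w<y⇒u<y : ∀ u y → InS u → ¬ InS y → f w < f y → f u < f y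
        w<y⇒u<y u y u∈S y∉S w<y with u Fin.≟ w
        ... | yes refl = w<y
        ... | no  u≢w  = <-transfer (f w) (f u) (f y)
          (subst₂ _<_ (D-sym u w) (sym (outside-δ u y u∈S y∉S)) (outside-farther u y u∈S u≢w y∉S)) w<y

        u<y⇒w<y : ∀ u y → InS u → ¬ InS y → f u < f y → f w < f y
        u<y⇒w<y u y u∈S y∉S u<y with u Fin.≟ w
        ... | yes refl = u<y
        ... | no  u≢w  = <-transfer (f u) (f w) (f y) (outside-farther u y u∈S u≢w y∉S) u<y

        y<w⇒y<u : ∀ u y → InS u → ¬ InS y → f y < f w → f y < f u
        y<w⇒y<u u y u∈S y∉S y<w with <-cmp (f u) (f y)
        ... | tri< u<y _ _ = ⊥-elim (<-asym y<w (u<y⇒w<y u y u∈S y∉S u<y))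
        ... | tri≈ _ e _   = ⊥-elim (y∉S (subst InS (f-inj e) u∈S))
        ... | tri> _ _ y<u = y<u

        w-represents : Represents G f (t , s) S w
        w-represents u y z u∈S y∉S z∉S e = first , middle , last
          where
          iu : InS u
          iu = ∈subsetOf⁻ InS? u∈S
          ny : ¬ InS y
          ny = ∉S⁻ y∉S
          nz : ¬ InS z
          nz = ∉S⁻ z∉S
          first : f w < f y → f y < f z → φ (f w) (f y) (f z) ≡ (t , s)
          first w<y y<z = recolour w y z u y z (outside-δ u y iu ny) refl
                                (mono u y z (E-swap₁₂ G (E-swap₂₃ G e)) (w<y⇒u<y u y iu ny w<y) y<z)
          middle : f y < f w → f w < f z → φ (f y) (f w) (f z) ≡ (t , s)
          middle y<w w<z =
            recolour y w z y u z (trans (D-sym y w) (trans (outside-δ u y iu ny) (D-sym u y)))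
                     (outside-δ u z iu nz)
                     (mono y u z (E-swap₂₃ G e) (y<w⇒y<u u y iu ny y<w) (w<y⇒u<y u z iu nz w<z))
          last : f y < f z → f z < f w → φ (f y) (f z) (f w) ≡ (t , s)
          last y<z z<w =
            recolour y z w y z u refl (trans (D-sym z w) (trans (outside-δ u z iu nz) (D-sym u z)))
                     (mono y z u e y<z (y<w⇒y<u u z iu nz z<w))

        -- Only if M = 0 could w lie at distance M from itself, and then v, w are not far apart.
        M-distant-∉S : ∀ u → D u w ≡ M → ¬ InS u
        M-distant-∉S u DuM (inj₂ far')  = far' (subst (λ d → Agree t d M) (sym DuM) (agree-refl M))
        M-distant-∉S u DuM (inj₁ refl) = far (subst (λ d → Agree t d M) (sym Dvw≡M) (agree-refl M))
          where
          Dvw≡M : D v w ≡ M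
          Dvw≡M = ≤-antisym (D≤M v w) (subst (_≤ D v w) (trans (sym (δ-self (f w))) DuM) z≤n)

        M≤Dpw⊔Dwp' : M ≤ D p w ⊔ D w p'
        M≤Dpw⊔Dwp' = subst (_≤ D p w ⊔ D w p') DpM (δ-ultra (f p) (f w) (f p'))

        outside-vertex : ∃[ u ] u ∉ S
        outside-vertex with ⊔-sel (D p w) (D w p')
        ... | inj₁ e = p  , M-distant-∉S p (≤-antisym (D≤M p w) (subst (M ≤_) e M≤Dpw⊔Dwp'))
                            ∘ ∈subsetOf⁻ InS?
        ... | inj₂ e = p' , M-distant-∉S p' (trans (D-sym p' w) (≤-antisym (D≤M w p') (subst (M ≤_) e M≤Dpw⊔Dwp')))
                            ∘ ∈subsetOf⁻ InS?

        w∈S : w ∈ S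
        w∈S = ∈subsetOf⁺ InS? (inj₁ refl)

        S-collapsible : Collapsible G S
        S-collapsible =
          2≤∣p∣ (∈subsetOf⁺ InS? (inj₂ far)) w∈S v≢w , ∣p∣<n (proj₂ outside-vertex) ,
          count3-sorted (_≢ 2) S no-two
          where
          ∈S⁻ : ∀ {u} → u ∈ S → InS u
          ∈S⁻ = ∈subsetOf⁻ InS?
          no-two : ∀ x y z → E G x y z → f x < f y → f y < f z → count3 S x y z ≢ 2
          no-two x y z e x<y y<z two with count3≡2⇒ S x y z two
          ... | inj₁ (x∈S , y∈S , z∉S) =
            S-separated x y (∈S⁻ x∈S) (∈S⁻ y∈S) (<ᶠ⇒≢ x<y)
              (agree-trans (D x y) (D y z) M (edge-agree e x<y y<z)
                (S-near-outside y z (∈S⁻ y∈S) (∉S⁻ z∉S)))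
          ... | inj₂ (inj₁ (x∈S , y∉S , z∈S)) =
            S-separated x z (∈S⁻ x∈S) (∈S⁻ z∈S) (<ᶠ⇒≢ (<-trans x<y y<z))
              (agree-convex (D x y) (D x z) M (δ-monoʳ (f x) (f y) (f z) x<y (<⇒≤ y<z)) (D≤M x z)
                (S-near-outside x y (∈S⁻ x∈S) (∉S⁻ y∉S)))
          ... | inj₂ (inj₂ (x∉S , y∈S , z∈S)) =
            S-separated y z (∈S⁻ y∈S) (∈S⁻ z∈S) (<ᶠ⇒≢ y<z)
              (agree-trans (D y z) (D x y) M (agree-sym (D x y) (D y z) (edge-agree e x<y y<z))
                (near-sym y x (S-near-outside y x (∈S⁻ y∈S) (∉S⁻ x∉S))))

        result : 𝒰⁺ G
        result = by-collapse S S-collapsible w w∈S w-represents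

    module NearPairs (near : ∀ i j → i ≢ j → Near i j) where

      Up : V → V → Set
      Up i j = bit (D i j) t ≡ 1

      ¬Up-self : ∀ i → ¬ Up i i
      ¬Up-self i up = 0≢1+n (trans (sym (trans (cong (λ d → bit d t) (δ-self (f i))) (bit-of-0 t))) up)

      ¬Up⇒0 : ∀ {i j} → ¬ Up i j → bit (D i j) t ≡ 0
      ¬Up⇒0 {i} {j} ¬up = [ id , ⊥-elim ∘ ¬up ]′ (bit-binary (D i j) t)

      up-sym : ∀ i j → Up i j → Up j i
      up-sym i j = subst (λ d → bit d t ≡ 1) (D-sym i j)

      agree-pairs : ∀ i j k l → i ≢ j → k ≢ l → Agree t (D i j) (D k l)
      agree-pairs i j k l i≢j k≢l =
        agree-trans (D i j) M (D k l) (near i j i≢j) (agree-sym (D k l) M (near k l k≢l))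

      up-upward : ∀ i j k l → D i j ≤ D k l → k ≢ l → Up i j → Up k l
      up-upward i j k l le k≢l up = agree-bit-mono (D i j) (D k l) (agree-pairs i j k l i≢j k≢l) le up
        where i≢j : i ≢ j
              i≢j refl = ¬Up-self i up

      up-spread : ∀ i j k → Up i k → Up i j ⊎ Up j k
      up-spread i j k up with j Fin.≟ i | j Fin.≟ k
      ... | yes refl | _        = inj₂ up
      ... | no _     | yes refl = inj₁ up
      ... | no j≢i   | no j≢k   = Sum.map (λ e → up-upward i k i j (ultra e) (j≢i ∘ sym) up)
                                          (λ e → up-upward i k j k (ultra e) j≢k up)
                                          (⊔-sel (D i j) (D j k))
        where ultra : ∀ {d} → D i j ⊔ D j k ≡ d → D i k ≤ d
              ultra e = subst (D i k ≤_) e (δ-ultra (f i) (f j) (f k))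

      module Around (w : V) where

        Up? : Decidable (λ u → Up u w)
        Up? u = bit (D u w) t ≟ 1

        U : Subset (n G)
        U = subsetOf Up?

        ∈U⁻ : ∀ {u} → u ∈ U → Up u w
        ∈U⁻ = ∈subsetOf⁻ Up?

        ∉U⁻ : ∀ {u} → u ∉ U → ¬ Up u w
        ∉U⁻ u∉U = u∉U ∘ ∈subsetOf⁺ Up?

        w∉U : w ∉ U
        w∉U = ¬Up-self w ∘ ∈U⁻

        across : ∀ {u y} → u ∈ U → y ∉ U → Up u y
        across {u} {y} u∈U y∉U = [ id , ⊥-elim ∘ ∉U⁻ y∉U ]′ (up-spread u y w (∈U⁻ u∈U))

        outside-low : ∀ {y z} → y ∉ U → z ∉ U → bit (D y z) t ≡ 0
        outside-low {y} {z} y∉U z∉U =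
          ¬Up⇒0 ([ ∉U⁻ y∉U , ∉U⁻ z∉U ∘ up-sym w z ]′ ∘ up-spread y w z)

        U-result : (∀ x y z → E G x y z → f x < f y → f y < f z → count3 U x y z ≢ 2) →
                   (∀ x y z → E G x y z → f x < f y → f y < f z → ¬ (x ∉ U × y ∉ U × z ∉ U)) →
                   (∀ rep → rep ∈ U → Represents G f (t , s) U rep) → 𝒰⁺ G
        U-result no-two no-outside represents
          with Fin.any? (λ a → Fin.any? (λ b → ¬? (a Fin.≟ b) ×-dec (a ∈? U ×-dec b ∈? U)))
        ... | yes (a , b , a≢b , a∈U , b∈U) =
          by-collapse U (2≤∣p∣ a∈U b∈U a≢b , ∣p∣<n w∉U , count3-sorted (_≢ 2) U no-two)
                      a a∈U (represents a a∈U)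
        ... | no no-pair = by-transversal U (count3-sorted (_≡ 1) U once)
          where
          once : ∀ x y z → E G x y z → f x < f y → f y < f z → count3 U x y z ≡ 1
          once x y z e x<y y<z = count3≡1 U x y z (no-two x y z e x<y y<z)
            (λ (x∈U , y∈U , _) → no-pair (x , y , <ᶠ⇒≢ x<y , x∈U , y∈U)) (no-outside x y z e x<y y<z)

      module Decreasing (s≡true : s ≡ true) (w : V) (w-max : ∀ j → f j ≤ f w) where

        open Around w

        edge-bits : ∀ {x y z} → E G x y z → f x < f y → f y < f z → Up x y × bit (D y z) t ≡ 0
        edge-bits {x} {y} {z} e x<y y<z = subst (λ d → bit (D x y) d ≡ 1) δ≡t (proj₂ bits) ,
                                          subst (λ d → bit (D y z) d ≡ 0) δ≡t (proj₁ bits)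
          where
          bits : bit (D y z) (δ (D y z) (D x y)) ≡ 0 × bit (D x y) (δ (D y z) (D x y)) ≡ 1
          bits = bits-at-δ-< (D y z) (D x y) (gtB-true⁻ _ _ (trans (edge-gtB e x<y y<z) s≡true))
          δ≡t : δ (D y z) (D x y) ≡ t
          δ≡t = trans (δ-sym (D y z) (D x y)) (edge-δ e x<y y<z)

        U-below : ∀ {u y} → u ∈ U → y ∉ U → f u < f y
        U-below {u} {y} u∈U y∉U with <-cmp (f u) (f y)
        ... | tri< u<y _ _ = u<y
        ... | tri≈ _ e _   = ⊥-elim (y∉U (subst (_∈ U) (f-inj e) u∈U))
        ... | tri> _ _ y<u = ⊥-elim (∉U⁻ y∉U
          (up-upward y u y w (δ-monoʳ (f y) (f u) (f w) y<u (w-max u)) (λ { refl → <⇒≱ y<u (w-max u) })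
            (up-sym u y (across u∈U y∉U))))

        result : 𝒰⁺ G
        result = U-result no-two no-outside represents
          where
          no-two : ∀ x y z → E G x y z → f x < f y → f y < f z → count3 U x y z ≢ 2
          no-two x y z e x<y y<z two with count3≡2⇒ U x y z two
          ... | inj₁ (_ , y∈U , z∉U)         =
            0≢1+n (trans (sym (proj₂ (edge-bits e x<y y<z))) (across y∈U z∉U))
          ... | inj₂ (inj₁ (_ , y∉U , z∈U)) = <-asym y<z (U-below z∈U y∉U)
          ... | inj₂ (inj₂ (x∉U , y∈U , _)) = <-asym x<y (U-below y∈U x∉U)

          no-outside : ∀ x y z → E G x y z → f x < f y → f y < f z → ¬ (x ∉ U × y ∉ U × z ∉ U)
          no-outside x y z e x<y y<z (x∉U , y∉U , _) =
            0≢1+n (trans (sym (outside-low x∉U y∉U)) (proj₁ (edge-bits e x<y y<z)))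

          represents : ∀ rep → rep ∈ U → Represents G f (t , s) U rep
          represents rep rep∈U u y z _ y∉U z∉U e =
            first , (λ y<rep _ → ⊥-elim (<-asym y<rep (U-below rep∈U y∉U)))
                  , (λ _ z<rep → ⊥-elim (<-asym z<rep (U-below rep∈U z∉U)))
            where
            first : f rep < f y → f y < f z → φ (f rep) (f y) (f z) ≡ (t , s)
            first rep<y _ = cong₂ _,_ (proj₁ split) (trans (gtB-true⁺ _ _ (proj₂ split)) (sym s≡true))
              where
              split : δ (D rep y) (D y z) ≡ t × D y z < D rep y
              split = agree-split (D rep y) (D y z)
                        (agree-pairs rep y y z (<ᶠ⇒≢ rep<y) (proj₁ (E-distinct G e)))
                        (across rep∈U y∉U) (outside-low y∉U z∉U)

      module Increasing (s≡false : s ≡ false) (w : V) (w-min : ∀ j → f w ≤ f j) where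

        open Around w

        edge-bits : ∀ {x y z} → E G x y z → f x < f y → f y < f z → bit (D x y) t ≡ 0 × Up y z
        edge-bits {x} {y} {z} e x<y y<z =
          subst (λ d → bit (D x y) d ≡ 0) (edge-δ e x<y y<z) (proj₁ bits) ,
          subst (λ d → bit (D y z) d ≡ 1) (edge-δ e x<y y<z) (proj₂ bits)
          where
          Dxy<Dyz : D x y < D y z
          Dxy<Dyz = ≤∧≢⇒< (≮⇒≥ (gtB-false⁻ _ _ (trans (edge-gtB e x<y y<z) s≡false)))
                          (δ-consecutive-≢ (f x) (f y) (f z) x<y y<z)
          bits : bit (D x y) (δ (D x y) (D y z)) ≡ 0 × bit (D y z) (δ (D x y) (D y z)) ≡ 1
          bits = bits-at-δ-< (D x y) (D y z) Dxy<Dyz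

        U-above : ∀ {u y} → u ∈ U → y ∉ U → f y < f u
        U-above {u} {y} u∈U y∉U with <-cmp (f u) (f y)
        ... | tri> _ _ y<u = y<u
        ... | tri≈ _ e _   = ⊥-elim (y∉U (subst (_∈ U) (f-inj e) u∈U))
        ... | tri< u<y _ _ = ⊥-elim (∉U⁻ y∉U (up-sym w y
          (up-upward u y w y (δ-antimonoˡ (f w) (f u) (f y) (w-min u) u<y) (λ { refl → <⇒≱ u<y (w-min u) })
            (across u∈U y∉U))))

        result : 𝒰⁺ G
        result = U-result no-two no-outside represents
          where
          no-two : ∀ x y z → E G x y z → f x < f y → f y < f z → count3 U x y z ≢ 2
          no-two x y z e x<y y<z two with count3≡2⇒ U x y z two
          ... | inj₁ (_ , y∈U , z∉U)         = <-asym y<z (U-above y∈U z∉U)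
          ... | inj₂ (inj₁ (x∈U , y∉U , _)) = <-asym x<y (U-above x∈U y∉U)
          ... | inj₂ (inj₂ (x∉U , y∈U , _)) =
            0≢1+n (trans (sym (proj₁ (edge-bits e x<y y<z))) (up-sym y x (across y∈U x∉U)))

          no-outside : ∀ x y z → E G x y z → f x < f y → f y < f z → ¬ (x ∉ U × y ∉ U × z ∉ U)
          no-outside x y z e x<y y<z (_ , y∉U , z∉U) =
            0≢1+n (trans (sym (outside-low y∉U z∉U)) (proj₂ (edge-bits e x<y y<z)))

          represents : ∀ rep → rep ∈ U → Represents G f (t , s) U rep
          represents rep rep∈U u y z _ y∉U z∉U e =
            (λ rep<y _ → ⊥-elim (<-asym rep<y (U-above rep∈U y∉U))) ,
            (λ _ rep<z → ⊥-elim (<-asym rep<z (U-above rep∈U z∉U))) ,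
            last
            where
            last : f y < f z → f z < f rep → φ (f y) (f z) (f rep) ≡ (t , s)
            last _ z<rep = cong₂ _,_ (trans (δ-sym (D y z) (D z rep)) (proj₁ split))
                                     (trans (gtB-false⁺ _ _ (<-asym (proj₂ split))) (sym s≡false))
              where
              split : δ (D z rep) (D y z) ≡ t × D y z < D z rep
              split = agree-split (D z rep) (D y z)
                        (agree-pairs z rep y z (<ᶠ⇒≢ z<rep) (proj₁ (E-distinct G e)))
                        (up-sym rep z (across rep∈U z∉U)) (outside-low y∉U z∉U)

  near-case : ∀ M → (∀ i j → i ≢ j → Near M i j) → V → 𝒰⁺ G
  near-case M near x₀ = by-orientation s refl
    where
    by-orientation : ∀ b → s ≡ b → 𝒰⁺ G
    by-orientation true  s≡ = let (w , w-max) = maximiser x₀ f in NearPairs.Decreasing.result M near s≡ w w-max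
    by-orientation false s≡ = let (w , w-min) = minimiser x₀ f in NearPairs.Increasing.result M near s≡ w w-min

  FarPairExists : ℕ → Set
  FarPairExists M = ∃[ v ] ∃[ w ] (v ≢ w × ¬ Near M v w)

  far-pair? : ∀ M → Dec (FarPairExists M)
  far-pair? M = Fin.any? λ v → Fin.any? λ w → ¬? (v Fin.≟ w) ×-dec ¬? (δ (D v w) M ≤? t)

  from-maximum : ∀ M → (∀ i j → D i j ≤ M) → ∀ p p' → D p p' ≡ M → V → Dec (FarPairExists M) → 𝒰⁺ G
  from-maximum M D≤M p p' DpM _  (yes (v , w , v≢w , far)) = FarPair.result M D≤M p p' DpM v w v≢w far
  from-maximum M D≤M p p' DpM x₀ (no no-far)                = near-case M near x₀
    where near : ∀ i j → i ≢ j → Near M i j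
          near i j i≢j = decidable-stable (δ (D i j) M ≤? t) λ far → no-far (i , j , i≢j , far)

  result : 𝒰⁺ G
  result with inhabited? (n G)
  ... | inj₂ empty = by-transversal ∅ (λ x → ⊥-elim (empty x))
  ... | inj₁ x₀    = let ((p , p') , D≤M) = pair-maximiser x₀ D in
                     from-maximum (D p p') D≤M p p' refl x₀ (far-pair? (D p p'))

monochromatic⇒𝒰⁺ : ∀ G → MonoEmbedding G → 𝒰⁺ G
monochromatic⇒𝒰⁺ = WF.All.wfRec (On.wellFounded n <-wellFounded) _ (λ G → MonoEmbedding G → 𝒰⁺ G) step
  where
  step : ∀ G → (∀ {H} → n H < n G → MonoEmbedding H → 𝒰⁺ H) → MonoEmbedding G → 𝒰⁺ G
  step G ih (f , f-inj , (t , s) , mono) = Step.result G f f-inj t s mono ih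

lemma2p6 : (q : ℕ) → 0 < q → q % 2 ≡ 0 → (G : Graph3) → MonoCopy (Nq q) G → InUnion G
lemma2p6 _ _ _ G (f , f-inj , _ , c , mono) with monochromatic⇒𝒰⁺ G (f , f-inj , c , mono)
... | k , G∈𝒰 = suc k , G∈𝒰
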